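{- For every integer $n\ge 1$, there exists a common subsequence of $\mu^n(0)$ and $\mu^n(1)$ of length at least $2^n\left(1-\frac{1}{n/4}\right)$.
   Context: $\mu$ is the morphism on binary words defined by $\mu(0)=01$, $\mu(1)=10$, and $\mu^n$ is its $n$-fold iterate (so $\mu^n(0)$, the $n$-th Thue–Morse word, and $\mu^n(1)$, its bitwise complement, have length $2^n$). A common subsequence of two words is a word that is a (not necessarily contiguous) subsequence of both. -}

module Defs where

open import Data.Bool using (Bool; true; false)
open import Data.Nat using (ℕ; zero; suc)
open import Data.List using (List; []; _∷_; concatMap)

-- binary letters: false = 0, true = 1
-- the Thue–Morse morphism μ(0) = 01, μ(1) = 10
μ₁ : Bool → List Bool
μ₁ false = false ∷ true ∷ []
μ₁ true  = true ∷ false ∷ []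

μ : List Bool → List Bool
μ = concatMap μ₁

μ^ : ℕ → List Bool → List Bool
μ^ zero    w = w
μ^ (suc n) w = μ (μ^ n w)

module Submission where

-- Write Pₖ(b) = μᵏ(b) for the level-k Thue–Morse blocks.  Since
-- μ(a) = a(¬a) and μ commutes with complementation, for any seed word u = a s₁ … s_L
-- the words μ^{k+1}(u) and μ^{k+1}(¬u) are the block sequences
--   Pₖ(a)Pₖ(¬a)Pₖ(s₁)Pₖ(¬s₁)…   and   Pₖ(¬a)Pₖ(a)Pₖ(¬s₁)Pₖ(s₁)… .
-- If w is a common subsequence of Pₖ(0) and Pₖ(1), the comb
--   Pₖ(a) w Pₖ(s₁) w … w Pₖ(s_L)
-- is a subsequence of both: the full blocks are matched exactly and every copy of w
-- fits into the block between them.  With the seed u = μᵐ(0) this turns a common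
-- subsequence of μᵏ(0), μᵏ(1) of deficit d (length 2ᵏ - d) into one of
-- μ^{k+m+1}(0), μ^{k+m+1}(1) of deficit 2ᵏ + (2ᵐ - 1)d  (`combine`).
-- For balanced k ≈ m this step preserves the bound d·n ≤ 4·2ⁿ (`step`), so a strong
-- induction (k = 7+c+j, m = 5+j, n = 13+c+2j) proves the bound for all n ≥ 13,
-- while n ≤ 12 is settled by evaluating the construction on small cases.

open import Defs
open import Data.Bool using (Bool; true; false; not)
open import Data.Bool.Properties using (not-involutive)
open import Data.List using (List; []; _∷_; length; _++_; map)
open import Data.List.Properties using (length-++; ++-assoc)
open import Data.List.Relation.Binary.Sublist.Propositional using (_⊆_; ⊆-refl; minimum)
open import Data.List.Relation.Binary.Sublist.Propositional.Properties using (++⁺; ++⁺ˡ; ++⁺ʳ)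
open import Data.Nat
open import Data.Nat.Properties
open import Data.Nat.DivMod using (_/_; _%_; m≡m%n+[m/n]*n; m%n<n)
open import Data.Nat.Induction using (<-rec)
open import Data.Nat.Tactic.RingSolver using (solve-∀)
open import Data.Product using (∃-syntax; _×_; _,_)
open import Data.Unit using (tt)
open import Data.Empty using (⊥-elim)
open import Relation.Binary.PropositionalEquality

μ-++ : ∀ u v → μ (u ++ v) ≡ μ u ++ μ v
μ-++ []      v = refl
μ-++ (a ∷ u) v = trans (cong (μ₁ a ++_) (μ-++ u v)) (sym (++-assoc (μ₁ a) (μ u) (μ v)))

μ^-++ : ∀ k u v → μ^ k (u ++ v) ≡ μ^ k u ++ μ^ k v
μ^-++ zero    u v = refl
μ^-++ (suc k) u v = trans (cong μ (μ^-++ k u v)) (μ-++ (μ^ k u) (μ^ k v))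

μ^-[] : ∀ k → μ^ k [] ≡ []
μ^-[] zero    = refl
μ^-[] (suc k) = cong μ (μ^-[] k)

-- μ commutes with complementation; this is what relates μⁿ(1) to μⁿ(0).
μ-not : ∀ w → μ (map not w) ≡ map not (μ w)
μ-not []          = refl
μ-not (false ∷ w) = cong (λ x → true ∷ false ∷ x) (μ-not w)
μ-not (true ∷ w)  = cong (λ x → false ∷ true ∷ x) (μ-not w)

μ^-not : ∀ k w → μ^ k (map not w) ≡ map not (μ^ k w)
μ^-not zero    w = refl
μ^-not (suc k) w = trans (cong μ (μ^-not k w)) (μ-not (μ^ k w))

μ^-+ : ∀ k m w → μ^ (k + m) w ≡ μ^ k (μ^ m w)
μ^-+ zero    m w = refl
μ^-+ (suc k) m w = cong μ (μ^-+ k m w)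

μ^-suc : ∀ k w → μ^ (suc k) w ≡ μ^ k (μ w)
μ^-suc zero    w = refl
μ^-suc (suc k) w = cong μ (μ^-suc k w)

length-μ : ∀ w → length (μ w) ≡ 2 * length w
length-μ []          = refl
length-μ (false ∷ w) = trans (cong (2 +_) (length-μ w)) (sym (*-suc 2 (length w)))
length-μ (true ∷ w)  = trans (cong (2 +_) (length-μ w)) (sym (*-suc 2 (length w)))

length-μ^ : ∀ k w → length (μ^ k w) ≡ 2 ^ k * length w
length-μ^ zero    w = sym (+-identityʳ (length w))
length-μ^ (suc k) w = begin
  length (μ (μ^ k w))     ≡⟨ length-μ (μ^ k w) ⟩
  2 * length (μ^ k w)     ≡⟨ cong (2 *_) (length-μ^ k w) ⟩
  2 * (2 ^ k * length w)  ≡⟨ sym (*-assoc 2 (2 ^ k) (length w)) ⟩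
  2 ^ suc k * length w    ∎
  where open ≡-Reasoning

-- Block decomposition of μ^{k+1}

block : ℕ → Bool → List Bool
block k b = μ^ k (b ∷ [])

length-block : ∀ k b → length (block k b) ≡ 2 ^ k
length-block k b = trans (length-μ^ k (b ∷ [])) (*-identityʳ (2 ^ k))

pairs : (Bool → List Bool) → List Bool → List Bool
pairs Q []      = []
pairs Q (a ∷ s) = Q a ++ Q (not a) ++ pairs Q s

μ-singleton : ∀ a → μ (a ∷ []) ≡ (a ∷ []) ++ (not a ∷ [])
μ-singleton false = refl
μ-singleton true  = refl

μ^-suc-singleton : ∀ k a → μ^ (suc k) (a ∷ []) ≡ block k a ++ block k (not a)
μ^-suc-singleton k a = begin
  μ^ (suc k) (a ∷ [])              ≡⟨ μ^-suc k (a ∷ []) ⟩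
  μ^ k (μ (a ∷ []))                ≡⟨ cong (μ^ k) (μ-singleton a) ⟩
  μ^ k ((a ∷ []) ++ (not a ∷ []))  ≡⟨ μ^-++ k (a ∷ []) (not a ∷ []) ⟩
  block k a ++ block k (not a)     ∎
  where open ≡-Reasoning

μ^-suc-pairs : ∀ k s → μ^ (suc k) s ≡ pairs (block k) s
μ^-suc-pairs k []      = μ^-[] (suc k)
μ^-suc-pairs k (a ∷ s) = begin
  μ^ (suc k) ((a ∷ []) ++ s)
    ≡⟨ μ^-++ (suc k) (a ∷ []) s ⟩
  μ^ (suc k) (a ∷ []) ++ μ^ (suc k) s
    ≡⟨ cong₂ _++_ (μ^-suc-singleton k a) (μ^-suc-pairs k s) ⟩
  (block k a ++ block k (not a)) ++ pairs (block k) s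
    ≡⟨ ++-assoc (block k a) (block k (not a)) (pairs (block k) s) ⟩
  pairs (block k) (a ∷ s) ∎
  where open ≡-Reasoning

-- The comb: a common subsequence of pairs Q u and pairs Q (¬u)

module Comb (Q : Bool → List Bool) {w : List Bool} (w⊆Q : ∀ b → w ⊆ Q b) where

  comb : Bool → List Bool → List Bool
  comb a []      = Q a
  comb a (b ∷ s) = Q a ++ w ++ comb b s

  -- In Q(a)Q(¬a)Q(b)Q(¬b)…, the blocks Q(a), Q(b), … are matched and w sits in Q(¬a).
  comb⊆pairs : ∀ a s → comb a s ⊆ pairs Q (a ∷ s)
  comb⊆pairs a []      = ++⁺ʳ (Q (not a) ++ []) ⊆-refl
  comb⊆pairs a (b ∷ s) = ++⁺ (⊆-refl {x = Q a}) (++⁺ (w⊆Q (not a)) (comb⊆pairs b s))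

  ⊆-Q-not-not : ∀ {xs} b ys → xs ⊆ Q b ++ ys → xs ⊆ Q (not (not b)) ++ ys
  ⊆-Q-not-not b ys = subst (λ c → _ ⊆ Q c ++ ys) (sym (not-involutive b))

  -- In the complemented word the blocks are shifted by one: Q(¬a)[Q(a)Q(¬b)][Q(b)…
  comb⊆shifted : ∀ a s → comb a s ⊆ Q a ++ pairs Q (map not s)
  comb⊆shifted a []      = ++⁺ʳ [] ⊆-refl
  comb⊆shifted a (b ∷ s) =
    ++⁺ (⊆-refl {x = Q a}) (++⁺ (w⊆Q (not b)) (⊆-Q-not-not b _ (comb⊆shifted b s)))

  comb⊆pairs-not : ∀ a s → comb a s ⊆ pairs Q (map not (a ∷ s))
  comb⊆pairs-not a s = ++⁺ˡ (Q (not a)) (⊆-Q-not-not a _ (comb⊆shifted a s))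

  -- with blocks of length p, the comb has L + 1 blocks and L copies of w
  length-comb : ∀ {p} → (∀ b → length (Q b) ≡ p) →
                ∀ a s → length (comb a s) ≡ p + length s * (length w + p)
  length-comb {p} length-Q a []      = trans (length-Q a) (sym (+-identityʳ p))
  length-comb {p} length-Q a (b ∷ s) = begin
    length (Q a ++ w ++ comb b s)
      ≡⟨ length-++ (Q a) ⟩
    length (Q a) + length (w ++ comb b s)
      ≡⟨ cong₂ _+_ (length-Q a) (length-++ w) ⟩
    p + (length w + length (comb b s))
      ≡⟨ cong (λ x → p + (length w + x)) (length-comb length-Q b s) ⟩
    p + (length w + (p + length s * (length w + p)))
      ≡⟨ regroup p (length w) (length s) ⟩
    p + suc (length s) * (length w + p) ∎
    where
    open ≡-Reasoning
    regroup : ∀ p l L → p + (l + (p + L * (l + p))) ≡ p + suc L * (l + p)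
    regroup = solve-∀

-- Common subsequences of μⁿ(0) and μⁿ(1) of prescribed deficit

record CommonSub (n d : ℕ) : Set where
  field
    word    : List Bool
    sub₀    : word ⊆ μ^ n (false ∷ [])
    sub₁    : word ⊆ μ^ n (true ∷ [])
    deficit : length word + d ≡ 2 ^ n

emptySub : ∀ n → CommonSub n (2 ^ n)
emptySub n = record { word = [] ; sub₀ = minimum _ ; sub₁ = minimum _ ; deficit = refl }

-- The length bookkeeping of `combine`, with p = 2ᵏ, L + 1 = 2ᵐ, l + d = p.
combine-length : ∀ p L l d → l + d ≡ p → p + L * (l + p) + (p + L * d) ≡ 2 * (p * suc L)
combine-length p L l d l+d≡p = begin
  p + L * (l + p) + (p + L * d)  ≡⟨ regroup p L l d ⟩
  p + p + L * ((l + d) + p)      ≡⟨ cong (λ x → p + p + L * (x + p)) l+d≡p ⟩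
  p + p + L * (p + p)            ≡⟨ factor p L ⟩
  2 * (p * suc L)                ∎
  where
  open ≡-Reasoning
  regroup : ∀ p L l d → p + L * (l + p) + (p + L * d) ≡ p + p + L * ((l + d) + p)
  regroup = solve-∀
  factor : ∀ p L → p + p + L * (p + p) ≡ 2 * (p * suc L)
  factor = solve-∀

combine : ∀ {k d} m → CommonSub k d → CommonSub (suc (k + m)) (2 ^ k + (2 ^ m ∸ 1) * d)
combine {k} {d} m c with μ^ m (false ∷ []) in seed≡
... | [] = ⊥-elim (<⇒≢ (m^n>0 2 m) (trans (sym (cong length seed≡)) (length-block m false)))
... | a ∷ s = record
  { word = comb a s ; sub₀ = subst (comb a s ⊆_) (sym level₀) (comb⊆pairs a s)
  ; sub₁ = subst (comb a s ⊆_) (sym level₁) (comb⊆pairs-not a s) ; deficit = deficit′ }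
  where
  open ≡-Reasoning
  open CommonSub c
  w⊆block : ∀ b → word ⊆ block k b
  w⊆block false = sub₀
  w⊆block true  = sub₁
  open Comb (block k) w⊆block

  level₀ : μ^ (suc (k + m)) (false ∷ []) ≡ pairs (block k) (a ∷ s)
  level₀ = begin
    μ^ (suc k + m) (false ∷ [])     ≡⟨ μ^-+ (suc k) m (false ∷ []) ⟩
    μ^ (suc k) (μ^ m (false ∷ []))  ≡⟨ cong (μ^ (suc k)) seed≡ ⟩
    μ^ (suc k) (a ∷ s)              ≡⟨ μ^-suc-pairs k (a ∷ s) ⟩
    pairs (block k) (a ∷ s)         ∎

  level₁ : μ^ (suc (k + m)) (true ∷ []) ≡ pairs (block k) (map not (a ∷ s))
  level₁ = begin
    μ^ (suc k + m) (true ∷ [])                ≡⟨ μ^-+ (suc k) m (true ∷ []) ⟩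
    μ^ (suc k) (μ^ m (map not (false ∷ [])))  ≡⟨ cong (μ^ (suc k)) (μ^-not m (false ∷ [])) ⟩
    μ^ (suc k) (map not (μ^ m (false ∷ [])))  ≡⟨ cong (λ u → μ^ (suc k) (map not u)) seed≡ ⟩
    μ^ (suc k) (map not (a ∷ s))              ≡⟨ μ^-suc-pairs k (map not (a ∷ s)) ⟩
    pairs (block k) (map not (a ∷ s))         ∎

  length-seed : suc (length s) ≡ 2 ^ m
  length-seed = trans (sym (cong length seed≡)) (length-block m false)

  deficit′ : length (comb a s) + (2 ^ k + (2 ^ m ∸ 1) * d) ≡ 2 ^ suc (k + m)
  deficit′ = begin
    length (comb a s) + (2 ^ k + (2 ^ m ∸ 1) * d)
      ≡⟨ cong₂ (λ x L → x + (2 ^ k + L * d))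
               (length-comb (length-block k) a s) (cong (_∸ 1) (sym length-seed)) ⟩
    2 ^ k + length s * (length word + 2 ^ k) + (2 ^ k + length s * d)
      ≡⟨ combine-length (2 ^ k) (length s) (length word) d deficit ⟩
    2 * (2 ^ k * suc (length s))
      ≡⟨ cong (λ x → 2 * (2 ^ k * x)) length-seed ⟩
    2 * (2 ^ k * 2 ^ m)
      ≡⟨ cong (2 *_) (sym (^-distribˡ-+-* 2 k m)) ⟩
    2 ^ suc (k + m) ∎

-- The quantitative bound d·n ≤ 4·2ⁿ

Good : ℕ → Set
Good n = ∃[ d ] (CommonSub n d × d * n ≤ 4 * 2 ^ n)

-- Arithmetic core of `step`, with x = 2ᵏ, y = 2ᵐ: multiplying the target by k,
-- the old bound d·k ≤ 4x and the balance condition give k·d′·n ≤ k·8xy.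
step-arithmetic : ∀ k n x y d → d * k ≤ 4 * x → n * k + 4 * y * n ≤ 8 * y * k →
                  k * ((x + y * d) * n) ≤ k * (4 * (2 * (x * y)))
step-arithmetic k n x y d dk≤4x balanced = begin
  k * ((x + y * d) * n)            ≡⟨ expand k n x y d ⟩
  x * (n * k) + y * n * (d * k)    ≤⟨ +-monoʳ-≤ (x * (n * k)) (*-monoʳ-≤ (y * n) dk≤4x) ⟩
  x * (n * k) + y * n * (4 * x)    ≡⟨ collect k n x y ⟩
  x * (n * k + 4 * y * n)          ≤⟨ *-monoʳ-≤ x balanced ⟩
  x * (8 * y * k)                  ≡⟨ rearrange k x y ⟩
  k * (4 * (2 * (x * y)))          ∎
  where
  open ≤-Reasoning
  expand : ∀ k n x y d → k * ((x + y * d) * n) ≡ x * (n * k) + y * n * (d * k)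
  expand = solve-∀
  collect : ∀ k n x y → x * (n * k) + y * n * (4 * x) ≡ x * (n * k + 4 * y * n)
  collect = solve-∀
  rearrange : ∀ k x y → x * (8 * y * k) ≡ k * (4 * (2 * (x * y)))
  rearrange = solve-∀

-- `combine` preserves the bound when k and m are balanced (for n = k + m + 1:
-- n·k + 4·2ᵐ·n ≤ 8·2ᵐ·k, which forces m < k - 1).
step : ∀ {k} m → .{{_ : NonZero k}} →
       suc (k + m) * k + 4 * 2 ^ m * suc (k + m) ≤ 8 * 2 ^ m * k →
       Good k → Good (suc (k + m))
step {k} m balanced (d , c , dk≤) = _ , combine m c , *-cancelˡ-≤ k (begin
  k * ((2 ^ k + (2 ^ m ∸ 1) * d) * n)  ≤⟨ *-monoʳ-≤ k (*-monoˡ-≤ n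
                                            (+-monoʳ-≤ (2 ^ k) (*-monoˡ-≤ d (m∸n≤m (2 ^ m) 1)))) ⟩
  k * ((2 ^ k + 2 ^ m * d) * n)        ≤⟨ step-arithmetic k n (2 ^ k) (2 ^ m) d dk≤ balanced ⟩
  k * (4 * (2 * (2 ^ k * 2 ^ m)))      ≡⟨ cong (λ x → k * (4 * (2 * x))) (sym (^-distribˡ-+-* 2 k m)) ⟩
  k * (4 * 2 ^ n)                      ∎)
  where
  open ≤-Reasoning
  n = suc (k + m)

balanced : ∀ c m → let k = 2 + c + m in
           suc (k + m) * k ≤ 4 * suc c * 2 ^ m →
           suc (k + m) * k + 4 * 2 ^ m * suc (k + m) ≤ 8 * 2 ^ m * k
balanced c m nk≤ = begin
  suc (k + m) * k + 4 * 2 ^ m * suc (k + m)  ≤⟨ +-monoˡ-≤ (4 * 2 ^ m * suc (k + m)) nk≤ ⟩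
  4 * suc c * 2 ^ m + 4 * 2 ^ m * suc (k + m) ≡⟨ identity c m (2 ^ m) ⟩
  8 * 2 ^ m * k                               ∎
  where
  open ≤-Reasoning
  k = 2 + c + m
  identity : ∀ c m y → 4 * suc c * y + 4 * y * suc ((2 + c + m) + m) ≡ 8 * y * (2 + c + m)
  identity = solve-∀

quadratic≤exponential : ∀ j → (13 + 2 * j) * (7 + j) ≤ 128 * 2 ^ j
quadratic≤exponential zero    = ≤ᵇ⇒≤ _ _ tt
quadratic≤exponential (suc j) = begin
  (13 + 2 * suc j) * (7 + suc j)                               ≤⟨ m≤m+n _ _ ⟩
  (13 + 2 * suc j) * (7 + suc j) + (2 * j * j + 23 * j + 62)  ≡⟨ doubling j ⟩
  2 * ((13 + 2 * j) * (7 + j))                                 ≤⟨ *-monoʳ-≤ 2 (quadratic≤exponential j) ⟩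
  2 * (128 * 2 ^ j)                                            ≡⟨ *-comm 2 (128 * 2 ^ j) ⟩
  128 * 2 ^ j * 2                                              ≡⟨ *-assoc 128 (2 ^ j) 2 ⟩
  128 * (2 ^ j * 2)                                            ≡⟨ cong (128 *_) (*-comm (2 ^ j) 2) ⟩
  128 * 2 ^ suc j                                              ∎
  where
  open ≤-Reasoning
  doubling : ∀ j → (13 + 2 * suc j) * (7 + suc j) + (2 * j * j + 23 * j + 62)
                   ≡ 2 * ((13 + 2 * j) * (7 + j))
  doubling = solve-∀

balance₀ : ∀ j → suc ((7 + j) + (5 + j)) * (7 + j) ≤ 4 * 1 * 2 ^ (5 + j)
balance₀ j = begin
  suc ((7 + j) + (5 + j)) * (7 + j)  ≡⟨ cong (λ x → x * (7 + j)) (size j) ⟩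
  (13 + 2 * j) * (7 + j)             ≤⟨ quadratic≤exponential j ⟩
  128 * 2 ^ j                        ≡⟨ scale (2 ^ j) ⟩
  4 * 1 * 2 ^ (5 + j)                ∎
  where
  open ≤-Reasoning
  size : ∀ j → suc ((7 + j) + (5 + j)) ≡ 13 + 2 * j
  size = solve-∀
  scale : ∀ x → 128 * x ≡ 4 * 1 * (2 * (2 * (2 * (2 * (2 * x)))))
  scale = solve-∀

balance₁ : ∀ j → suc ((8 + j) + (5 + j)) * (8 + j) ≤ 4 * 2 * 2 ^ (5 + j)
balance₁ j = begin
  suc ((8 + j) + (5 + j)) * (8 + j)                     ≤⟨ m≤m+n _ _ ⟩
  suc ((8 + j) + (5 + j)) * (8 + j) + (2 * j * j + 24 * j + 70) ≡⟨ doubling j ⟩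
  2 * ((13 + 2 * j) * (7 + j))                          ≤⟨ *-monoʳ-≤ 2 (quadratic≤exponential j) ⟩
  2 * (128 * 2 ^ j)                                     ≡⟨ scale (2 ^ j) ⟩
  4 * 2 * 2 ^ (5 + j)                                   ∎
  where
  open ≤-Reasoning
  doubling : ∀ j → suc ((8 + j) + (5 + j)) * (8 + j) + (2 * j * j + 24 * j + 70)
                   ≡ 2 * ((13 + 2 * j) * (7 + j))
  doubling = solve-∀
  scale : ∀ x → 2 * (128 * x) ≡ 4 * 2 * (2 * (2 * (2 * (2 * (2 * x)))))
  scale = solve-∀

double : ∀ j c → c ≤ 1 → Good (7 + c + j) → Good (suc ((7 + c + j) + (5 + j)))
double j 0 z≤n       = step (5 + j) (balanced 0 (5 + j) (balance₀ j))
double j 1 (s≤s z≤n) = step (5 + j) (balanced 1 (5 + j) (balance₁ j))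

-- A common subsequence of μ³(0), μ³(1) of length 4, built from the empty word;
-- from it `combine` settles the small cases 5 ≤ n ≤ 12 by direct evaluation.
level3 : CommonSub 3 4
level3 = combine 2 (emptySub 0)

good : ∀ n → 1 ≤ n → Good n
good = <-rec (λ n → 1 ≤ n → Good n) body
  where
  -- for n ≤ 4 even the empty word is good enough
  trivial : ∀ n → 2 ^ n * n ≤ 4 * 2 ^ n → Good n
  trivial n bound = 2 ^ n , emptySub n , bound

  body : ∀ n → (∀ {k} → k < n → 1 ≤ k → Good k) → 1 ≤ n → Good n
  body 1  _ _ = trivial 1 (≤ᵇ⇒≤ _ _ tt)
  body 2  _ _ = trivial 2 (≤ᵇ⇒≤ _ _ tt)
  body 3  _ _ = trivial 3 (≤ᵇ⇒≤ _ _ tt)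
  body 4  _ _ = trivial 4 (≤ᵇ⇒≤ _ _ tt)
  body 5  _ _ = _ , combine 1 level3 , ≤ᵇ⇒≤ _ _ tt
  body 6  _ _ = _ , combine 2 level3 , ≤ᵇ⇒≤ _ _ tt
  body 7  _ _ = _ , combine 3 level3 , ≤ᵇ⇒≤ _ _ tt
  body 8  _ _ = _ , combine 4 level3 , ≤ᵇ⇒≤ _ _ tt
  body 9  _ _ = _ , combine 5 level3 , ≤ᵇ⇒≤ _ _ tt
  body 10 _ _ = _ , combine 6 level3 , ≤ᵇ⇒≤ _ _ tt
  body 11 _ _ = _ , combine 7 level3 , ≤ᵇ⇒≤ _ _ tt
  body 12 _ _ = _ , combine 8 level3 , ≤ᵇ⇒≤ _ _ tt
  body n@(suc (suc (suc (suc (suc (suc (suc (suc (suc (suc (suc (suc (suc r))))))))))))) rec _ =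
    subst Good size (double j c c≤1 (rec k<n (s≤s z≤n)))
    where
    -- write n = 13 + r with r = c + 2j, c ∈ {0, 1}, and recurse at k = 7 + c + j
    j = r / 2
    c = r % 2
    c≤1 : c ≤ 1
    c≤1 = s≤s⁻¹ (m%n<n r 2)
    r≡ : 13 + r ≡ 13 + (c + j * 2)
    r≡ = cong (13 +_) (m≡m%n+[m/n]*n r 2)
    halves : ∀ c j → 13 + (c + j * 2) ≡ suc ((7 + c + j) + (5 + j))
    halves = solve-∀
    size : suc ((7 + c + j) + (5 + j)) ≡ n
    size = sym (trans r≡ (halves c j))
    k<n : 7 + c + j < n
    k<n = subst (7 + c + j <_) size (m≤m+n (suc (7 + c + j)) (5 + j))

theorem2 : (n : ℕ) → 1 ≤ n →
    ∃[ w ] (w ⊆ μ^ n (false ∷ []) × w ⊆ μ^ n (true ∷ [])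
    × 2 ^ n * n ≤ length w * n + 4 * 2 ^ n)
theorem2 n 1≤n with good n 1≤n
... | d , c , dn≤ = word , sub₀ , sub₁ , (begin
  2 ^ n * n                 ≡⟨ cong (_* n) (sym deficit) ⟩
  (length word + d) * n     ≡⟨ *-distribʳ-+ n (length word) d ⟩
  length word * n + d * n   ≤⟨ +-monoʳ-≤ (length word * n) dn≤ ⟩
  length word * n + 4 * 2 ^ n ∎)
  where
  open CommonSub c
  open ≤-Reasoning
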